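{- If there is a function $f$ such that for every integer $d\ge 1$, every $G\in\mathcal{F}$ and every $d$-neighborhood system $\Sigma$ for $G$ satisfy $\omega(\Sigma)\le f(\rho(\Sigma),d)$, then the class $\mathcal{F}$ is nowhere dense.
   Context: Graphs are finite and simple. For a vertex $v$ of $G$, $N^d(v)$ is the set of vertices at distance at most $d$ from $v$, excluding $v$. A $d$-neighborhood system for $G$ is a collection $(\Sigma(v))_{v\in V(G)}$ with $\Sigma(v)\subseteq N^d(v)$; $\rho(\Sigma)=\max_v|\Sigma(v)|$. A $\Sigma$-clique is a set $C$ of vertices such that every two distinct $u,v\in C$ lie together in some $\Sigma(w)$; $\omega(\Sigma)$ is the maximum size of a $\Sigma$-clique. A graph $H$ is a shallow topological minor of $G$ at depth $d$ if $G$ contains as a subgraph a graph obtained from $H$ by subdividing each edge at most $2d$ times. A class $\mathcal{F}$ is somewhere dense if there is an integer $d$ such that every graph is a shallow topological minor at depth $d$ of some graph of $\mathcal{F}$; otherwise $\mathcal{F}$ is nowhere dense. -}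

module Defs where

open import Data.Nat using (ℕ; zero; suc; _+_; _*_; _≤_; _⊔_)
open import Data.Bool using (Bool; true; false)
open import Data.Fin using (Fin) renaming (_<_ to _<ᶠ_)
open import Data.Fin.Subset using (Subset; ∣_∣) renaming (_∈_ to _∈ₛ_)
open import Data.List using (List; []; _∷_; foldr; map; allFin; length)
open import Data.List.Membership.Propositional renaming (_∈_ to _∈ₗ_)
open import Data.List.Relation.Unary.Unique.Propositional using (Unique)
open import Data.Product using (Σ; _×_; ∃; ∃-syntax)
open import Relation.Nullary using (¬_)
open import Relation.Binary.PropositionalEquality using (_≡_; _≢_)
open import Function.Definitions using (Injective)

record Graph : Set where
  field
    n     : ℕ
    adj   : Fin n → Fin n → Bool
    sym   : ∀ u v → adj u v ≡ adj v u
    irr   : ∀ u → adj u u ≡ false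

open Graph public

Adj : (G : Graph) → Fin (n G) → Fin (n G) → Set
Adj G u v = adj G u v ≡ true

data Walk (G : Graph) : Fin (n G) → Fin (n G) → ℕ → Set where
  stay : ∀ u → Walk G u u zero
  step : ∀ {u v w k} → Adj G u v → Walk G v w k → Walk G u w (suc k)

DistLe : (G : Graph) → ℕ → Fin (n G) → Fin (n G) → Set
DistLe G d u v = ∃[ k ] (k ≤ d × Walk G u v k)

InNd : (G : Graph) → ℕ → Fin (n G) → Fin (n G) → Set
InNd G d v u = (u ≢ v) × DistLe G d v u

NbhdSys : Graph → Set
NbhdSys G = Fin (n G) → Subset (n G)

IsNbhdSystem : (G : Graph) → ℕ → NbhdSys G → Set
IsNbhdSystem G d S = ∀ v u → u ∈ₛ S v → InNd G d v u

ρ : (G : Graph) → NbhdSys G → ℕ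
ρ G S = foldr _⊔_ 0 (map (λ v → ∣ S v ∣) (allFin (n G)))

IsΣClique : (G : Graph) → NbhdSys G → Subset (n G) → Set
IsΣClique G S C = ∀ u v → u ∈ₛ C → v ∈ₛ C → u ≢ v →
  ∃[ w ] (u ∈ₛ S w × v ∈ₛ S w)

ωLe : (G : Graph) → NbhdSys G → ℕ → Set
ωLe G S m = ∀ C → IsΣClique G S C → ∣ C ∣ ≤ m

Chain : (G : Graph) → Fin (n G) → List (Fin (n G)) → Fin (n G) → Set
Chain G x [] y = Adj G x y
Chain G x (z ∷ zs) y = Adj G x z × Chain G z zs y

-- H is a shallow topological minor of G at depth d: G contains as a subgraph
-- a graph obtained from H by subdividing each edge at most 2d times.
-- φ = branch vertices; for each edge ab of H (a < b) an internal vertex list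
-- P a b of length ≤ 2d forming a path φ a – P – φ b; paths are internally
-- vertex-disjoint and avoid branch vertices.
record ShallowTopMinor (H G : Graph) (d : ℕ) : Set where
  field
    φ        : Fin (n H) → Fin (n G)
    φ-inj    : Injective _≡_ _≡_ φ
    P        : (a b : Fin (n H)) → List (Fin (n G))
    P-chain  : ∀ a b → a <ᶠ b → Adj H a b → Chain G (φ a) (P a b) (φ b)
    P-len    : ∀ a b → a <ᶠ b → Adj H a b → length (P a b) ≤ 2 * d
    P-uniq   : ∀ a b → a <ᶠ b → Adj H a b → Unique (P a b)
    P-avoid  : ∀ a b → a <ᶠ b → Adj H a b → ∀ c → ¬ (φ c ∈ₗ P a b)
    P-disj   : ∀ a b a' b' → a <ᶠ b → Adj H a b → a' <ᶠ b' → Adj H a' b' →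
               ¬ (a ≡ a' × b ≡ b') → ∀ x → x ∈ₗ P a b → ¬ (x ∈ₗ P a' b')

SomewhereDense : (Graph → Set) → Set
SomewhereDense 𝓕 = ∃[ d ] (∀ (H : Graph) → ∃[ G ] (𝓕 G × ShallowTopMinor H G d))

NowhereDense : (Graph → Set) → Set
NowhereDense 𝓕 = ¬ SomewhereDense 𝓕

module Submission where

-- If 𝓕 were somewhere dense at depth d, then for every m the graph H_m
-- obtained from the complete graph K_m by subdividing each edge once
-- (one middle vertex for every ordered pair of branch vertices) would be a
-- shallow topological minor at depth d of some G ∈ 𝓕.  In G, give the image
-- w of the middle vertex of the pair (a , b) the neighbourhood
-- Σ(w) = {φ a , φ b} and every other vertex the empty set.  Every subdivided
-- edge has length at most 2d + 1, so Σ is a (2d+1)-neighbourhood system;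
-- moreover ρ(Σ) ≤ 2, while the m branch vertices form a Σ-clique.  Hence
-- m ≤ ω(Σ) ≤ max {f(r, 2d+1) | r ≤ 2}, which fails for m one larger than
-- that maximum.

open import Defs
open import Data.Nat using (ℕ; zero; suc; _+_; _*_; _≤_; _⊔_; z≤n; s≤s)
open import Data.Nat.Properties
  using (≤-refl; ≤-trans; ≤-reflexive; +-suc; m≤m+n; m≤n+m; m≤m⊔n; m≤n⊔m; ⊔-lub;
         m≤n⇒m<n∨m≡n; n≮n; module ≤-Reasoning)
open import Data.Bool using (Bool; true; false)
open import Data.Fin using (Fin; _↑ˡ_; _↑ʳ_; splitAt; combine; remQuot; toℕ; _≟_)
  renaming (_<_ to _<ᶠ_)
open import Data.Fin.Properties
  using (0≢1+n; suc-injective; splitAt-↑ˡ; splitAt-↑ʳ; ↑ˡ-injective; ↑ʳ-injective;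
         toℕ-↑ˡ; toℕ-↑ʳ; toℕ<n; combine-injective; remQuot-combine; any?)
open import Data.Fin.Subset using (Subset; ∣_∣; _∈_; _⊆_; ⁅_⁆; _∪_; _-_; inside; outside; Empty)
open import Data.Fin.Subset.Properties
  using (p⊆q⇒∣p∣≤∣q∣; ∣⁅x⁆∣≡1; x∈⁅x⁆; x∈p∪q⁺; x∈p∧x≢y⇒x∈p-y; x∈p⇒∣p-x∣<∣p∣;
         Empty-unique; ∣⊥∣≡0)
open import Data.Vec using ([]; _∷_; tabulate)
open import Data.Vec.Properties using (lookup∘tabulate; []=⇒lookup; lookup⇒[]=)
open import Data.List using (List; length)
open import Data.List.Properties using (foldr-preservesᵇ)
open import Data.List.Relation.Unary.All.Properties using (map⁺; tabulate⁺)
open import Data.Sum using (_⊎_; inj₁; inj₂)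
open import Data.Product using (_×_; _,_; proj₁; proj₂; ∃; ∃₂)
open import Function using (_∘_)
open import Function.Definitions using (Injective)
open import Relation.Nullary using (Dec; yes; no; does)
open import Relation.Nullary.Decidable using (dec-true; _⊎-dec_; _×-dec_)
open import Relation.Unary using (Decidable)
open import Relation.Binary.PropositionalEquality
  using (_≡_; _≢_; refl; trans; cong; cong₂)
  renaming (sym to ≡-sym)

comprehension : ∀ {N} {P : Fin N → Set} → Decidable P → Subset N
comprehension P? = tabulate (does ∘ P?)

∈comprehension⁻ : ∀ {N} {P : Fin N → Set} (P? : Decidable P) {u} →
  u ∈ comprehension P? → P u
∈comprehension⁻ {P = P} P? {u} u∈ = from-does (P? u) does≡true
  where
  from-does : (d : Dec (P u)) → does d ≡ true → P u
  from-does (yes pu) _ = pu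
  from-does (no _)   ()

  does≡true : does (P? u) ≡ true
  does≡true = trans (≡-sym (lookup∘tabulate (does ∘ P?) u)) ([]=⇒lookup u∈)

∈comprehension⁺ : ∀ {N} {P : Fin N → Set} (P? : Decidable P) {u} →
  P u → u ∈ comprehension P?
∈comprehension⁺ P? {u} pu =
  lookup⇒[]= u (comprehension P?) (trans (lookup∘tabulate (does ∘ P?) u) (dec-true (P? u) pu))

∣p∪q∣≤∣p∣+∣q∣ : ∀ {N} (p q : Subset N) → ∣ p ∪ q ∣ ≤ ∣ p ∣ + ∣ q ∣
∣p∪q∣≤∣p∣+∣q∣ []            []            = z≤n
∣p∪q∣≤∣p∣+∣q∣ (inside ∷ p)  (inside ∷ q)  =
  s≤s (≤-trans (∣p∪q∣≤∣p∣+∣q∣ p q) (≤-trans (m≤n+m _ 1) (≤-reflexive (≡-sym (+-suc ∣ p ∣ ∣ q ∣)))))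
∣p∪q∣≤∣p∣+∣q∣ (inside ∷ p)  (outside ∷ q) = s≤s (∣p∪q∣≤∣p∣+∣q∣ p q)
∣p∪q∣≤∣p∣+∣q∣ (outside ∷ p) (inside ∷ q)  =
  ≤-trans (s≤s (∣p∪q∣≤∣p∣+∣q∣ p q)) (≤-reflexive (≡-sym (+-suc ∣ p ∣ ∣ q ∣)))
∣p∪q∣≤∣p∣+∣q∣ (outside ∷ p) (outside ∷ q) = ∣p∪q∣≤∣p∣+∣q∣ p q

⊆pair⇒∣∣≤2 : ∀ {N} {s : Subset N} x y → s ⊆ ⁅ x ⁆ ∪ ⁅ y ⁆ → ∣ s ∣ ≤ 2
⊆pair⇒∣∣≤2 {s = s} x y s⊆ = begin
  ∣ s ∣                   ≤⟨ p⊆q⇒∣p∣≤∣q∣ s⊆ ⟩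
  ∣ ⁅ x ⁆ ∪ ⁅ y ⁆ ∣       ≤⟨ ∣p∪q∣≤∣p∣+∣q∣ ⁅ x ⁆ ⁅ y ⁆ ⟩
  ∣ ⁅ x ⁆ ∣ + ∣ ⁅ y ⁆ ∣   ≡⟨ cong₂ _+_ (∣⁅x⁆∣≡1 x) (∣⁅x⁆∣≡1 y) ⟩
  2                       ∎
  where open ≤-Reasoning

empty⇒∣∣≤ : ∀ {N k} {s : Subset N} → Empty s → ∣ s ∣ ≤ k
empty⇒∣∣≤ {N} empty = ≤-trans (≤-reflexive (trans (cong ∣_∣ (Empty-unique empty)) (∣⊥∣≡0 N))) z≤n

injection⇒≤∣∣ : ∀ {m N} (g : Fin m → Fin N) → Injective _≡_ _≡_ g →
  (C : Subset N) → (∀ i → g i ∈ C) → m ≤ ∣ C ∣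
injection⇒≤∣∣ {zero}  g g-inj C g∈C = z≤n
injection⇒≤∣∣ {suc m} g g-inj C g∈C =
  ≤-trans (s≤s (injection⇒≤∣∣ (g ∘ Fin.suc) (suc-injective ∘ g-inj) (C - g Fin.zero) rest∈))
          (x∈p⇒∣p-x∣<∣p∣ (g∈C Fin.zero))
  where
  rest∈ : ∀ i → g (Fin.suc i) ∈ C - g Fin.zero
  rest∈ i = x∈p∧x≢y⇒x∈p-y (g∈C (Fin.suc i)) (λ e → 0≢1+n (≡-sym (g-inj e)))

ρ≤ : ∀ (G : Graph) (S : NbhdSys G) {k} → (∀ v → ∣ S v ∣ ≤ k) → ρ G S ≤ k
ρ≤ G S {k} bound = foldr-preservesᵇ {P = _≤ k} ⊔-lub z≤n (map⁺ (tabulate⁺ bound))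

maxUpTo : (ℕ → ℕ) → ℕ → ℕ
maxUpTo g zero    = g zero
maxUpTo g (suc k) = maxUpTo g k ⊔ g (suc k)

≤-maxUpTo : ∀ (g : ℕ → ℕ) {r k} → r ≤ k → g r ≤ maxUpTo g k
≤-maxUpTo g {k = zero}  z≤n = ≤-refl
≤-maxUpTo g {k = suc k} r≤k with m≤n⇒m<n∨m≡n r≤k
... | inj₁ (s≤s r≤k') = ≤-trans (≤-maxUpTo g r≤k') (m≤m⊔n _ _)
... | inj₂ refl       = m≤n⊔m _ _

module _ {G : Graph} where

  _▷_ : ∀ {u v w k} → Walk G u v k → Adj G v w → Walk G u w (suc k)
  stay u   ▷ e′ = step e′ (stay _)
  step e p ▷ e′ = step e (p ▷ e′)

  reverse : ∀ {u v k} → Walk G u v k → Walk G v u k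
  reverse (stay u)           = stay u
  reverse (step {u} {v} e p) = reverse p ▷ trans (Graph.sym G v u) e

  chain⇒walk : ∀ {x y} zs → Chain G x zs y → Walk G x y (suc (length zs))
  chain⇒walk List.[]       e        = step e (stay _)
  chain⇒walk (z List.∷ zs) (e , c) = step e (chain⇒walk zs c)

bipartite : (p q : ℕ) → (Fin p → Fin q → Bool) → Graph
bipartite p q E = record
  { n   = p + q
  ; adj = λ x y → adj′ (splitAt p x) (splitAt p y)
  ; sym = λ x y → sym′ (splitAt p x) (splitAt p y)
  ; irr = λ x → irr′ (splitAt p x)
  }
  where
  adj′ : Fin p ⊎ Fin q → Fin p ⊎ Fin q → Bool
  adj′ (inj₁ a) (inj₂ e) = E a e
  adj′ (inj₂ e) (inj₁ a) = E a e
  adj′ (inj₁ _) (inj₁ _) = false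
  adj′ (inj₂ _) (inj₂ _) = false

  sym′ : ∀ x y → adj′ x y ≡ adj′ y x
  sym′ (inj₁ _) (inj₂ _) = refl
  sym′ (inj₂ _) (inj₁ _) = refl
  sym′ (inj₁ _) (inj₁ _) = refl
  sym′ (inj₂ _) (inj₂ _) = refl

  irr′ : ∀ x → adj′ x x ≡ false
  irr′ (inj₁ _) = refl
  irr′ (inj₂ _) = refl

bipartite-adj : ∀ {p q} (E : Fin p → Fin q → Bool) {a e} →
  E a e ≡ true → Adj (bipartite p q E) (a ↑ˡ q) (p ↑ʳ e)
bipartite-adj {p} {q} E {a} {e} incident
  rewrite splitAt-↑ˡ p a q | splitAt-↑ʳ p q e = incident

-- H_m: the once-subdivided complete graph on m branch vertices, with one
-- middle vertex for every ordered pair (a , b), adjacent to a and b.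
module SubdividedClique (m : ℕ) where

  IsEnd : Fin m → Fin (m * m) → Set
  IsEnd c e = c ≡ proj₁ (remQuot {m} m e) ⊎ c ≡ proj₂ (remQuot {m} m e)

  isEnd? : ∀ c e → Dec (IsEnd c e)
  isEnd? c e = (c ≟ proj₁ (remQuot {m} m e)) ⊎-dec (c ≟ proj₂ (remQuot {m} m e))

  end? : Fin m → Fin (m * m) → Bool
  end? c e = does (isEnd? c e)

  H : Graph
  H = bipartite m (m * m) end?

  branch : Fin m → Fin (n H)
  branch a = a ↑ˡ (m * m)

  mid : Fin m → Fin m → Fin (n H)
  mid a b = m ↑ʳ combine a b

  mid-adjˡ : ∀ a b → Adj H (branch a) (mid a b)
  mid-adjˡ a b = bipartite-adj end?
    (dec-true (isEnd? a (combine a b)) (inj₁ (cong proj₁ (≡-sym (remQuot-combine {m} {m} a b)))))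

  mid-adjʳ : ∀ a b → Adj H (branch b) (mid a b)
  mid-adjʳ a b = bipartite-adj end?
    (dec-true (isEnd? b (combine a b)) (inj₂ (cong proj₂ (≡-sym (remQuot-combine {m} {m} a b)))))

  -- branch vertices precede middle vertices, so the minor stores the
  -- subdivision path of the edge {branch c , mid a b} in that orientation
  branch<mid : ∀ c a b → branch c <ᶠ mid a b
  branch<mid c a b rewrite toℕ-↑ˡ c (m * m) | toℕ-↑ʳ m (combine a b) =
    ≤-trans (toℕ<n c) (m≤m+n m (toℕ (combine a b)))

  branch≢mid : ∀ c a b → branch c ≢ mid a b
  branch≢mid c a b eq with trans (≡-sym (splitAt-↑ˡ m c (m * m)))
                                 (trans (cong (splitAt m) eq) (splitAt-↑ʳ m (m * m) (combine a b)))
  ... | ()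

  branch-injective : Injective _≡_ _≡_ branch
  branch-injective = ↑ˡ-injective (m * m) _ _

  mid-injective : ∀ {a b a′ b′} → mid a b ≡ mid a′ b′ → a ≡ a′ × b ≡ b′
  mid-injective eq = combine-injective _ _ _ _ (↑ʳ-injective m _ _ eq)

module InducedSystem {m : ℕ} {G : Graph} {d : ℕ}
                     (M : ShallowTopMinor (SubdividedClique.H m) G d) where

  open SubdividedClique m
  open ShallowTopMinor M

  IsEndOf : Fin (n G) → Fin (n G) → Set
  IsEndOf w u = ∃₂ λ a b → w ≡ φ (mid a b) × (u ≡ φ (branch a) ⊎ u ≡ φ (branch b))

  isEndOf? : ∀ w → Decidable (IsEndOf w)
  isEndOf? w u = any? λ a → any? λ b →
    (w ≟ φ (mid a b)) ×-dec ((u ≟ φ (branch a)) ⊎-dec (u ≟ φ (branch b)))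

  system : NbhdSys G
  system w = comprehension (isEndOf? w)

  end-near : ∀ c a b → Adj H (branch c) (mid a b) →
    InNd G (suc (2 * d)) (φ (mid a b)) (φ (branch c))
  end-near c a b e =
    (branch≢mid c a b ∘ φ-inj) ,
    (suc (length path) , s≤s (P-len _ _ (branch<mid c a b) e) ,
     reverse (chain⇒walk path (P-chain _ _ (branch<mid c a b) e)))
    where
    path : List (Fin (n G))
    path = P (branch c) (mid a b)

  system-isNbhd : IsNbhdSystem G (suc (2 * d)) system
  system-isNbhd w u u∈ with ∈comprehension⁻ (isEndOf? w) u∈
  ... | a , b , refl , inj₁ refl = end-near a a b (mid-adjˡ a b)
  ... | a , b , refl , inj₂ refl = end-near b a b (mid-adjʳ a b)

  -- since φ is injective, the image of a middle vertex determines its pair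
  ends-determined : ∀ {w u a b} → w ≡ φ (mid a b) → IsEndOf w u →
    u ∈ ⁅ φ (branch a) ⁆ ∪ ⁅ φ (branch b) ⁆
  ends-determined w≡ (a′ , b′ , w≡′ , _)
    with mid-injective (φ-inj (trans (≡-sym w≡) w≡′))
  ends-determined _ (_ , _ , _ , inj₁ refl) | refl , refl = x∈p∪q⁺ (inj₁ (x∈⁅x⁆ _))
  ends-determined _ (_ , _ , _ , inj₂ refl) | refl , refl = x∈p∪q⁺ (inj₂ (x∈⁅x⁆ _))

  system-small : ∀ w → ∣ system w ∣ ≤ 2
  system-small w with any? (λ a → any? (λ b → w ≟ φ (mid a b)))
  ... | yes (a , b , w≡) =
    ⊆pair⇒∣∣≤2 (φ (branch a)) (φ (branch b)) (ends-determined w≡ ∘ ∈comprehension⁻ (isEndOf? w))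
  ... | no notMid = empty⇒∣∣≤ λ (u , u∈) → notMid (middle (∈comprehension⁻ (isEndOf? w) u∈))
    where
    middle : ∀ {u} → IsEndOf w u → ∃₂ λ a b → w ≡ φ (mid a b)
    middle (a , b , w≡ , _) = a , b , w≡

  ρ≤2 : ρ G system ≤ 2
  ρ≤2 = ρ≤ G system system-small

  IsBranch : Fin (n G) → Set
  IsBranch u = ∃ λ a → u ≡ φ (branch a)

  isBranch? : Decidable IsBranch
  isBranch? u = any? λ a → u ≟ φ (branch a)

  branches : Subset (n G)
  branches = comprehension isBranch?

  branches-clique : IsΣClique G system branches
  branches-clique u v u∈ v∈ _
    with ∈comprehension⁻ isBranch? u∈ | ∈comprehension⁻ isBranch? v∈
  ... | a , refl | b , refl =
    φ (mid a b) ,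
    ∈comprehension⁺ (isEndOf? _) (a , b , refl , inj₁ refl) ,
    ∈comprehension⁺ (isEndOf? _) (a , b , refl , inj₂ refl)

  m≤∣branches∣ : m ≤ ∣ branches ∣
  m≤∣branches∣ =
    injection⇒≤∣∣ (φ ∘ branch) (branch-injective ∘ φ-inj) branches
      (λ a → ∈comprehension⁺ isBranch? (a , refl))

lemma15 : (𝓕 : Graph → Set) → (f : ℕ → ℕ → ℕ) →
    (∀ (d : ℕ) → 1 ≤ d → ∀ (G : Graph) → 𝓕 G →
    ∀ (S : NbhdSys G) → IsNbhdSystem G d S → ωLe G S (f (ρ G S) d)) →
    NowhereDense 𝓕
lemma15 𝓕 f ω-bounded (d , dense) = n≮n K m≤K
  where
  radius : ℕ
  radius = suc (2 * d)

  -- a bound on ω(Σ) valid whenever ρ(Σ) ≤ 2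
  K : ℕ
  K = maxUpTo (λ r → f r radius) 2

  m : ℕ
  m = suc K

  open SubdividedClique m using (H)

  G : Graph
  G = proj₁ (dense H)

  open InducedSystem (proj₂ (proj₂ (dense H)))

  m≤K : m ≤ K
  m≤K = begin
    m                          ≤⟨ m≤∣branches∣ ⟩
    ∣ branches ∣               ≤⟨ ω-bounded radius (s≤s z≤n) G (proj₁ (proj₂ (dense H)))
                                    system system-isNbhd branches branches-clique ⟩
    f (ρ G system) radius      ≤⟨ ≤-maxUpTo (λ r → f r radius) ρ≤2 ⟩
    K                          ∎
    where open ≤-Reasoning
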